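{- Let $G$ be a graph and $(S,\overline S)$ a cut of $G$. Suppose a vertex $v$ has at least $5/9$ of its edges crossing the cut, and $v$ is moved to the other side of the cut. Then the cut size $|\partial_G S|$ decreases by at least $d_G(v)/9$. Moreover, if the conductance of the cut was below $1/9$ before the move, the move (strictly) decreases the conductance.
   Context: Graphs are simple and undirected; $d_G(v)$ is the degree of $v$. $\mathrm{vol}_G(S)=\sum_{v\in S}d_G(v)$, $\partial_GS$ is the set of edges between $S$ and $\overline S=V(G)\setminus S$, and the conductance of the cut is $\phi(G,S)=|\partial_GS|/\min\{\mathrm{vol}_G(S),\mathrm{vol}_G(\overline S)\}$. -}

module Defs where

open import Data.Bool using (Bool; true; false; if_then_else_; _∧_; _xor_; not)
open import Data.Nat using (ℕ; zero; suc; _+_; NonZero) renaming (_⊓_ to min)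
open import Data.Fin using (Fin; zero; suc)
open import Data.Fin.Subset using (Subset; ∁)
open import Data.Vec using (lookup; _[_]≔_)
open import Data.Integer using (+_)
open import Data.Rational using (ℚ; _/_)
open import Relation.Binary.PropositionalEquality using (_≡_)

record Graph (n : ℕ) : Set where
  field
    adj    : Fin n → Fin n → Bool
    sym    : ∀ i j → adj i j ≡ adj j i
    irrefl : ∀ i → adj i i ≡ false
open Graph public

count : {n : ℕ} → (Fin n → Bool) → ℕ
count {zero}  f = 0
count {suc n} f = (if f zero then 1 else 0) + count (λ i → f (suc i))

sumF : {n : ℕ} → (Fin n → ℕ) → ℕ
sumF {zero}  g = 0
sumF {suc n} g = g zero + sumF (λ i → g (suc i))

deg : {n : ℕ} → Graph n → Fin n → ℕ
deg G v = count (adj G v)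

vol : {n : ℕ} → Graph n → Subset n → ℕ
vol G S = sumF (λ v → if lookup S v then deg G v else 0)

-- |∂_G S|: each crossing edge {i,j} with i ∈ S, j ∉ S counted once
-- (as the ordered pair (i , j)).
cutSize : {n : ℕ} → Graph n → Subset n → ℕ
cutSize G S = sumF (λ i → if lookup S i
                          then count (λ j → adj G i j ∧ not (lookup S j))
                          else 0)

crossDeg : {n : ℕ} → Graph n → Subset n → Fin n → ℕ
crossDeg G S v = count (λ j → adj G v j ∧ (lookup S v xor lookup S j))

minVol : {n : ℕ} → Graph n → Subset n → ℕ
minVol G S = min (vol G S) (vol G (∁ S))

conductance : {n : ℕ} → (G : Graph n) → (S : Subset n) → .{{NonZero (minVol G S)}} → ℚ
conductance G S = (+ cutSize G S) / minVol G S

move : {n : ℕ} → Subset n → Fin n → Subset n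
move S v = S [ v ]≔ not (lookup S v)

-- Moving v changes the cut only by the edges at v: its c crossing edges stop
-- crossing and its d − c other edges start to, so |∂S'| = |∂S| + d − 2c, which
-- is at most |∂S| − d/9 once c ≥ 5d/9. Both volumes change by at most d, so the
-- smaller one does too. Since |∂S| < vol/9, losing d/9 edges outweighs losing d
-- volume, and the ratio drops.
module Submission where

open import Data.Bool using (Bool; true; false; if_then_else_; _∧_; _xor_; not)
open import Data.Bool.Properties using (not-involutive; ∧-zeroʳ)
open import Data.Empty using (⊥-elim)
open import Data.Fin using (Fin; zero; suc; _≟_)
open import Data.Fin.Properties using (suc-injective)
open import Data.Fin.Subset using (Subset; ∁)
open import Data.Integer as ℤ using (+_; +<+)
import Data.Integer.Properties as ℤ
open import Data.Nat as ℕ using (ℕ; zero; suc; _+_; _*_; _≤_; NonZero)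
import Data.Nat.Properties as ℕ
open import Algebra.Properties.CommutativeSemigroup ℕ.+-commutativeSemigroup using (interchange)
open import Data.Nat.Tactic.RingSolver using (solve-∀)
open import Data.Product using (_×_; Σ; _,_)
open import Data.Rational using (_<_; _/_; toℚᵘ)
open import Data.Rational.Properties using (toℚᵘ-cancel-<; toℚᵘ-mono-<; toℚᵘ-fromℚᵘ)
open import Data.Rational.Unnormalised as ℚᵘ using (mkℚᵘ; *<*)
import Data.Rational.Unnormalised.Properties as ℚᵘ
open import Data.Vec using (lookup)
open import Data.Vec.Properties using (lookup∘update; lookup∘update′; lookup-map)
open import Relation.Binary.PropositionalEquality
  using (_≡_; _≢_; refl; sym; trans; cong; cong₂; subst₂; module ≡-Reasoning)
open import Relation.Nullary using (yes; no)

open import Defs hiding (sym)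

ind : Bool → ℕ
ind b = if b then 1 else 0

if≤ : ∀ b m → (if b then m else 0) ≤ m
if≤ true  m = ℕ.≤-refl
if≤ false m = ℕ.z≤n

sumF-cong : ∀ {n} {g h : Fin n → ℕ} → (∀ i → g i ≡ h i) → sumF g ≡ sumF h
sumF-cong {zero}  g≗h = refl
sumF-cong {suc n} g≗h = cong₂ _+_ (g≗h zero) (sumF-cong (λ i → g≗h (suc i)))

sumF-+ : ∀ {n} (g h : Fin n → ℕ) → sumF (λ i → g i + h i) ≡ sumF g + sumF h
sumF-+ {zero}  g h = refl
sumF-+ {suc n} g h = begin
  (g zero + h zero) + sumF (λ i → g (suc i) + h (suc i))
    ≡⟨ cong (_+_ (g zero + h zero)) (sumF-+ (λ i → g (suc i)) (λ i → h (suc i))) ⟩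
  (g zero + h zero) + (sumF (λ i → g (suc i)) + sumF (λ i → h (suc i)))
    ≡⟨ interchange (g zero) (h zero) _ _ ⟩
  (g zero + sumF (λ i → g (suc i))) + (h zero + sumF (λ i → h (suc i))) ∎
  where open ≡-Reasoning

-- Stated additively to avoid truncated subtraction.
sumF-update : ∀ {n} (g h : Fin n → ℕ) (v : Fin n) → (∀ i → i ≢ v → g i ≡ h i) →
              sumF g + h v ≡ sumF h + g v
sumF-update g h zero g≗h = begin
  (g zero + sumF (λ i → g (suc i))) + h zero
    ≡⟨ cong (λ t → (g zero + t) + h zero) (sumF-cong (λ i → g≗h (suc i) λ ())) ⟩
  (g zero + sumF (λ i → h (suc i))) + h zero ≡⟨ ℕ.+-comm (g zero + _) (h zero) ⟩
  h zero + (g zero + sumF (λ i → h (suc i))) ≡⟨ cong (_+_ (h zero)) (ℕ.+-comm (g zero) _) ⟩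
  h zero + (sumF (λ i → h (suc i)) + g zero) ≡⟨ ℕ.+-assoc (h zero) _ (g zero) ⟨
  (h zero + sumF (λ i → h (suc i))) + g zero ∎
  where open ≡-Reasoning
sumF-update g h (suc v) g≗h = begin
  (g zero + sumF (λ i → g (suc i))) + h (suc v) ≡⟨ ℕ.+-assoc (g zero) _ _ ⟩
  g zero + (sumF (λ i → g (suc i)) + h (suc v))
    ≡⟨ cong₂ _+_ (g≗h zero λ ())
         (sumF-update (λ i → g (suc i)) (λ i → h (suc i)) v
                      (λ i i≢v → g≗h (suc i) (λ eq → i≢v (suc-injective eq)))) ⟩
  h zero + (sumF (λ i → h (suc i)) + g (suc v)) ≡⟨ ℕ.+-assoc (h zero) _ _ ⟨
  (h zero + sumF (λ i → h (suc i))) + g (suc v) ∎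
  where open ≡-Reasoning

count≡sumF-ind : ∀ {n} (f : Fin n → Bool) → count f ≡ sumF (λ i → ind (f i))
count≡sumF-ind {zero}  f = refl
count≡sumF-ind {suc n} f = cong (_+_ (ind (f zero))) (count≡sumF-ind (λ i → f (suc i)))

count-cong : ∀ {n} {f g : Fin n → Bool} → (∀ i → f i ≡ g i) → count f ≡ count g
count-cong {f = f} {g} f≗g = begin
  count f                 ≡⟨ count≡sumF-ind f ⟩
  sumF (λ i → ind (f i))  ≡⟨ sumF-cong (λ i → cong ind (f≗g i)) ⟩
  sumF (λ i → ind (g i))  ≡⟨ count≡sumF-ind g ⟨
  count g                 ∎
  where open ≡-Reasoning

count-update : ∀ {n} (f g : Fin n → Bool) (v : Fin n) → (∀ i → i ≢ v → f i ≡ g i) →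
               count f + ind (g v) ≡ count g + ind (f v)
count-update f g v f≗g = begin
  count f + ind (g v)                 ≡⟨ cong (_+ ind (g v)) (count≡sumF-ind f) ⟩
  sumF (λ i → ind (f i)) + ind (g v)  ≡⟨ sumF-update _ _ v (λ i i≢v → cong ind (f≗g i i≢v)) ⟩
  sumF (λ i → ind (g i)) + ind (f v)  ≡⟨ cong (_+ ind (f v)) (count≡sumF-ind g) ⟨
  count g + ind (f v)                 ∎
  where open ≡-Reasoning

count-false : ∀ {n} → count {n} (λ _ → false) ≡ 0
count-false {zero}  = refl
count-false {suc n} = count-false {n}

count-partition : ∀ {n} (f g : Fin n → Bool) →
                  count f ≡ count (λ i → f i ∧ g i) + count (λ i → f i ∧ not (g i))
count-partition {zero}  f g = refl
count-partition {suc n} f g with f zero | g zero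
... | true  | true  = cong suc (count-partition (λ i → f (suc i)) (λ i → g (suc i)))
... | true  | false = trans (cong suc (count-partition (λ i → f (suc i)) (λ i → g (suc i))))
                           (sym (ℕ.+-suc _ _))
... | false | _     = count-partition (λ i → f (suc i)) (λ i → g (suc i))

lookup-move : ∀ {n} (S : Subset n) v → lookup (move S v) v ≡ not (lookup S v)
lookup-move S v = lookup∘update v S (not (lookup S v))

lookup-move-≢ : ∀ {n} (S : Subset n) {v} i → i ≢ v → lookup (move S v) i ≡ lookup S i
lookup-move-≢ S {v} i i≢v = lookup∘update′ i≢v S (not (lookup S v))

lookup-∁ : ∀ {n} (S : Subset n) i → lookup (∁ S) i ≡ not (lookup S i)
lookup-∁ S i = lookup-map i not S

vol-≤-update : ∀ {n} (G : Graph n) (T T′ : Subset n) (v : Fin n) →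
               (∀ i → i ≢ v → lookup T′ i ≡ lookup T i) → vol G T ≤ vol G T′ + deg G v
vol-≤-update G T T′ v T′≗T = begin
  vol G T
    ≤⟨ ℕ.m≤m+n _ _ ⟩
  vol G T + (if lookup T′ v then deg G v else 0)
    ≡⟨ sumF-update _ _ v (λ i i≢v → cong (λ b → if b then deg G i else 0) (T′≗T i i≢v)) ⟨
  vol G T′ + (if lookup T v then deg G v else 0)
    ≤⟨ ℕ.+-monoʳ-≤ (vol G T′) (if≤ (lookup T v) (deg G v)) ⟩
  vol G T′ + deg G v ∎
  where open ℕ.≤-Reasoning

minVol-≤-move : ∀ {n} (G : Graph n) (S : Subset n) (v : Fin n) →
                minVol G S ≤ minVol G (move S v) + deg G v
minVol-≤-move G S v = begin
  ℕ._⊓_ (vol G S) (vol G (∁ S))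
    ≤⟨ ℕ.⊓-mono-≤ (vol-≤-update G S (move S v) v (lookup-move-≢ S))
                  (vol-≤-update G (∁ S) (∁ (move S v)) v ∁-agrees) ⟩
  ℕ._⊓_ (vol G (move S v) + deg G v) (vol G (∁ (move S v)) + deg G v)
    ≡⟨ ℕ.+-distribʳ-⊓ (deg G v) _ _ ⟨
  minVol G (move S v) + deg G v ∎
  where
    open ℕ.≤-Reasoning
    ∁-agrees : ∀ i → i ≢ v → lookup (∁ (move S v)) i ≡ lookup (∁ S) i
    ∁-agrees i i≢v = trans (lookup-∁ (move S v) i)
                       (trans (cong not (lookup-move-≢ S i i≢v)) (sym (lookup-∁ S i)))

module _ {n : ℕ} (G : Graph n) where

  outDeg : (Fin n → Bool) → Fin n → ℕ
  outDeg t i = count (λ j → adj G i j ∧ not (t j))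

  -- Ordered pairs (i , j) of adjacent vertices with s i and ¬ t j; cutSize G S
  -- is edgesOut (lookup S) (lookup S) by definition.
  edgesOut : (Fin n → Bool) → (Fin n → Bool) → ℕ
  edgesOut s t = sumF (λ i → if s i then outDeg t i else 0)

  edgesOut-updateˡ : ∀ s s′ t v → (∀ i → i ≢ v → s′ i ≡ s i) →
                     edgesOut s′ t + (if s v then outDeg t v else 0)
                     ≡ edgesOut s t + (if s′ v then outDeg t v else 0)
  edgesOut-updateˡ s s′ t v s′≗s =
    sumF-update _ _ v (λ i i≢v → cong (λ b → if b then outDeg t i else 0) (s′≗s i i≢v))

  neighboursIn : (Fin n → Bool) → Fin n → ℕ
  neighboursIn s v = count (λ i → adj G v i ∧ s i)

  sumF-adj-to : ∀ s v b → sumF (λ i → if s i then ind (adj G i v ∧ b) else 0)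
                          ≡ (if b then neighboursIn s v else 0)
  sumF-adj-to s v true = trans (sumF-cong pointwise) (sym (count≡sumF-ind (λ i → adj G v i ∧ s i)))
    where
      pointwise : ∀ i → (if s i then ind (adj G i v ∧ true) else 0) ≡ ind (adj G v i ∧ s i)
      pointwise i rewrite Graph.sym G i v with s i
      ... | true  = refl
      ... | false = cong ind (sym (∧-zeroʳ (adj G v i)))
  sumF-adj-to s v false = begin
    sumF (λ i → if s i then ind (adj G i v ∧ false) else 0) ≡⟨ sumF-cong pointwise ⟩
    sumF {n} (λ _ → ind false)                              ≡⟨ count≡sumF-ind {n} (λ _ → false) ⟨
    count {n} (λ _ → false)                                 ≡⟨ count-false {n} ⟩
    0                                                       ∎
    where
      open ≡-Reasoning
      pointwise : ∀ i → (if s i then ind (adj G i v ∧ false) else 0) ≡ 0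
      pointwise i with s i
      ... | true  = cong ind (∧-zeroʳ (adj G i v))
      ... | false = refl

  edgesOut-updateʳ : ∀ s t t′ v → (∀ i → i ≢ v → t′ i ≡ t i) →
                     edgesOut s t′ + (if not (t v) then neighboursIn s v else 0)
                     ≡ edgesOut s t + (if not (t′ v) then neighboursIn s v else 0)
  edgesOut-updateʳ s t t′ v t′≗t = begin
    edgesOut s t′ + (if not (t v) then neighboursIn s v else 0)
      ≡⟨ cong (_+_ (edgesOut s t′)) (sumF-adj-to s v (not (t v))) ⟨
    edgesOut s t′ + sumF (column t)          ≡⟨ sumF-+ _ (column t) ⟨
    sumF (λ i → row t′ i + column t i)       ≡⟨ sumF-cong rows ⟩
    sumF (λ i → row t i + column t′ i)       ≡⟨ sumF-+ _ (column t′) ⟩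
    edgesOut s t + sumF (column t′)
      ≡⟨ cong (_+_ (edgesOut s t)) (sumF-adj-to s v (not (t′ v))) ⟩
    edgesOut s t + (if not (t′ v) then neighboursIn s v else 0) ∎
    where
      open ≡-Reasoning
      row column : (Fin n → Bool) → Fin n → ℕ
      row    u i = if s i then outDeg u i else 0
      column u i = if s i then ind (adj G i v ∧ not (u v)) else 0
      rows : ∀ i → row t′ i + column t i ≡ row t i + column t′ i
      rows i with s i
      ... | true  = count-update _ _ v (λ j j≢v → cong (λ b → adj G i j ∧ not b) (t′≗t j j≢v))
      ... | false = refl

cut-arith : ∀ b C C′ R P Q →
            C′ + (if b then Q else 0) ≡ R + (if not b then Q else 0) →
            R + (if not b then P else 0) ≡ C + (if b then P else 0) →
            C′ + (if b then Q else P) + (if b then Q else P) ≡ C + (P + Q)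
cut-arith true C C′ R P Q rows cols = begin
  C′ + Q + Q   ≡⟨ cong (_+ Q) (trans rows cols) ⟩
  C + P + Q    ≡⟨ ℕ.+-assoc C P Q ⟩
  C + (P + Q)  ∎
  where open ≡-Reasoning
cut-arith false C C′ R P Q rows cols = begin
  C′ + P + P         ≡⟨ cong (λ t → t + P + P) (trans (sym (ℕ.+-identityʳ C′)) rows) ⟩
  R + Q + P + P      ≡⟨ rearrange R Q P ⟩
  (R + P) + (P + Q)  ≡⟨ cong (_+ (P + Q)) (trans cols (ℕ.+-identityʳ C)) ⟩
  C + (P + Q)        ∎
  where
    open ≡-Reasoning
    rearrange : ∀ R Q P → R + Q + P + P ≡ (R + P) + (P + Q)
    rearrange = solve-∀

module _ {n : ℕ} (G : Graph n) (S : Subset n) (v : Fin n) where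

  private
    x x′ : Fin n → Bool
    x  = lookup S
    x′ = lookup (move S v)

  outDeg-move : outDeg G x′ v ≡ outDeg G x v
  outDeg-move = count-cong pointwise
    where
      pointwise : ∀ j → (adj G v j ∧ not (x′ j)) ≡ (adj G v j ∧ not (x j))
      pointwise j with j ≟ v
      ... | yes refl rewrite irrefl G j = refl
      ... | no j≢v   = cong (λ b → adj G v j ∧ not b) (lookup-move-≢ S j j≢v)

  crossDeg≡ : crossDeg G S v ≡ (if x v then outDeg G x v else neighboursIn G x v)
  crossDeg≡ = by-side (x v)
    where
      by-side : ∀ b → count (λ j → adj G v j ∧ (b xor x j))
                      ≡ (if b then outDeg G x v else neighboursIn G x v)
      by-side true  = refl
      by-side false = refl

  cutSize-move : cutSize G (move S v) + crossDeg G S v + crossDeg G S v ≡ cutSize G S + deg G v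
  cutSize-move = begin
    cutSize G (move S v) + crossDeg G S v + crossDeg G S v
      ≡⟨ cong (λ c → cutSize G (move S v) + c + c) crossDeg≡ ⟩
    cutSize G (move S v) + (if x v then Q else P) + (if x v then Q else P)
      ≡⟨ cut-arith (x v) _ _ (edgesOut G x x′) P Q rows cols ⟩
    cutSize G S + (P + Q)
      ≡⟨ cong (_+_ (cutSize G S)) (count-partition (adj G v) x) ⟨
    cutSize G S + deg G v ∎
    where
      open ≡-Reasoning
      -- v is moved first among the sources i of the counted pairs (i , j), then among the targets j.
      P Q : ℕ
      P = neighboursIn G x v
      Q = outDeg G x v
      rows : cutSize G (move S v) + (if x v then Q else 0)
             ≡ edgesOut G x x′ + (if not (x v) then Q else 0)
      rows = begin
        cutSize G (move S v) + (if x v then Q else 0)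
          ≡⟨ cong (λ q → cutSize G (move S v) + (if x v then q else 0)) outDeg-move ⟨
        edgesOut G x′ x′ + (if x v then outDeg G x′ v else 0)
          ≡⟨ edgesOut-updateˡ G x x′ x′ v (lookup-move-≢ S) ⟩
        edgesOut G x x′ + (if x′ v then outDeg G x′ v else 0)
          ≡⟨ cong₂ (λ b q → edgesOut G x x′ + (if b then q else 0)) (lookup-move S v) outDeg-move ⟩
        edgesOut G x x′ + (if not (x v) then Q else 0) ∎
      cols : edgesOut G x x′ + (if not (x v) then P else 0)
             ≡ cutSize G S + (if x v then P else 0)
      cols = begin
        edgesOut G x x′ + (if not (x v) then P else 0)
          ≡⟨ edgesOut-updateʳ G x x x′ v (lookup-move-≢ S) ⟩
        cutSize G S + (if not (x′ v) then P else 0)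
          ≡⟨ cong (λ b → cutSize G S + (if b then P else 0))
                  (trans (cong not (lookup-move S v)) (not-involutive (x v))) ⟩
        cutSize G S + (if x v then P else 0) ∎

cut-drop : ∀ C C′ c d → C′ + c + c ≡ C + d → 5 * d ≤ 9 * c → 9 * C′ + d ≤ 9 * C
cut-drop C C′ c d moved 5d≤9c = ℕ.+-cancelʳ-≤ (18 * c) (9 * C′ + d) (9 * C) (begin
  (9 * C′ + d) + 18 * c  ≡⟨ expand C′ c d ⟩
  9 * (C′ + c + c) + d   ≡⟨ cong (λ t → 9 * t + d) moved ⟩
  9 * (C + d) + d        ≡⟨ regroup C d ⟩
  9 * C + 2 * (5 * d)    ≤⟨ ℕ.+-monoʳ-≤ (9 * C) (ℕ.*-monoʳ-≤ 2 5d≤9c) ⟩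
  9 * C + 2 * (9 * c)    ≡⟨ cong (_+_ (9 * C)) (ℕ.*-assoc 2 9 c) ⟨
  9 * C + 18 * c         ∎)
  where
    open ℕ.≤-Reasoning
    expand : ∀ C′ c d → (9 * C′ + d) + 18 * c ≡ 9 * (C′ + c + c) + d
    expand = solve-∀
    regroup : ∀ C d → 9 * (C + d) + d ≡ 9 * C + 2 * (5 * d)
    regroup = solve-∀

ratio-drop : ∀ C C′ m m′ d → 9 * C′ + d ≤ 9 * C → m ≤ m′ + d → C * 9 ℕ.< 1 * m → 1 ≤ d →
             C′ * m ℕ.< C * m′
ratio-drop C C′ m m′ d cut-dropped vol-dropped C*9<m 1≤d =
  ℕ.*-cancelˡ-< 9 (C′ * m) (C * m′) (ℕ.+-cancelʳ-< (d * m) (9 * (C′ * m)) (9 * (C * m′)) (begin-strict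
    9 * (C′ * m) + d * m    ≡⟨ factor C′ d m ⟩
    (9 * C′ + d) * m        ≤⟨ ℕ.*-monoˡ-≤ m cut-dropped ⟩
    9 * C * m               ≤⟨ ℕ.*-monoʳ-≤ (9 * C) vol-dropped ⟩
    9 * C * (m′ + d)        ≡⟨ distribute C m′ d ⟩
    9 * (C * m′) + 9 * C * d
      <⟨ ℕ.+-monoʳ-< (9 * (C * m′)) (ℕ.*-monoˡ-< d {{ℕ.>-nonZero 1≤d}} 9C<m) ⟩
    9 * (C * m′) + m * d    ≡⟨ cong (_+_ (9 * (C * m′))) (ℕ.*-comm m d) ⟩
    9 * (C * m′) + d * m    ∎))
  where
    open ℕ.≤-Reasoning
    9C<m : 9 * C ℕ.< m
    9C<m = subst₂ ℕ._<_ (ℕ.*-comm C 9) (ℕ.*-identityˡ m) C*9<m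
    factor : ∀ C′ d m → 9 * (C′ * m) + d * m ≡ (9 * C′ + d) * m
    factor = solve-∀
    distribute : ∀ C m′ d → 9 * C * (m′ + d) ≡ 9 * (C * m′) + 9 * C * d
    distribute = solve-∀

nonZero-of-<-* : ∀ a b c → a ℕ.< b * c → NonZero c
nonZero-of-<-* a b zero    a<b*0 = ⊥-elim (ℕ.n≮0 (subst₂ ℕ._<_ refl (ℕ.*-zeroʳ b) a<b*0))
nonZero-of-<-* a b (suc c) _     = _

toℚᵘ-/ : ∀ a b → toℚᵘ ((+ a) / suc b) ℚᵘ.≃ mkℚᵘ (+ a) b
toℚᵘ-/ a b = toℚᵘ-fromℚᵘ (mkℚᵘ (+ a) b)

*<⇒/< : ∀ a b c d .{{_ : NonZero b}} .{{_ : NonZero d}} → a * d ℕ.< c * b → (+ a) / b < (+ c) / d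
*<⇒/< a (suc b) c (suc d) ad<cb = toℚᵘ-cancel-<
  (ℚᵘ.<-respˡ-≃ (ℚᵘ.≃-sym (toℚᵘ-/ a b)) (ℚᵘ.<-respʳ-≃ (ℚᵘ.≃-sym (toℚᵘ-/ c d))
    (*<* (subst₂ ℤ._<_ (ℤ.pos-* a (suc d)) (ℤ.pos-* c (suc b)) (+<+ ad<cb)))))

/<⇒*< : ∀ a b c d .{{_ : NonZero b}} .{{_ : NonZero d}} → (+ a) / b < (+ c) / d → a * d ℕ.< c * b
/<⇒*< a (suc b) c (suc d) a/b<c/d
  with *<* ad<cb ← ℚᵘ.<-respˡ-≃ (toℚᵘ-/ a b) (ℚᵘ.<-respʳ-≃ (toℚᵘ-/ c d) (toℚᵘ-mono-< a/b<c/d))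
  = ℤ.drop‿+<+ (subst₂ ℤ._<_ (sym (ℤ.pos-* a (suc d))) (sym (ℤ.pos-* c (suc b))) ad<cb)

lemma8 : {n : ℕ} (G : Graph n) (S : Subset n) (v : Fin n) →
         1 ≤ deg G v →
         5 * deg G v ≤ 9 * crossDeg G S v →
         (9 * cutSize G (move S v) + deg G v ≤ 9 * cutSize G S)
         × ((nz : NonZero (minVol G S)) →
            conductance G S {{nz}} < (+ 1) / 9 →
            Σ (NonZero (minVol G (move S v)))
              (λ nz′ → conductance G (move S v) {{nz′}} < conductance G S {{nz}}))
lemma8 G S v 1≤d crossing = cut-dropped , conductance-drops
  where
    C C′ m m′ d : ℕ
    C  = cutSize G S
    C′ = cutSize G (move S v)
    m  = minVol G S
    m′ = minVol G (move S v)
    d  = deg G v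

    cut-dropped : 9 * C′ + d ≤ 9 * C
    cut-dropped = cut-drop C C′ (crossDeg G S v) d (cutSize-move G S v) crossing

    conductance-drops : (nz : NonZero m) → conductance G S {{nz}} < (+ 1) / 9 →
                        Σ (NonZero m′)
                          (λ nz′ → conductance G (move S v) {{nz′}} < conductance G S {{nz}})
    conductance-drops nz φ<1/9 = nz′ , *<⇒/< C′ m′ C m {{nz′}} {{nz}} cross-multiplied
      where
        cross-multiplied : C′ * m ℕ.< C * m′
        cross-multiplied = ratio-drop C C′ m m′ d cut-dropped (minVol-≤-move G S v)
                                      (/<⇒*< C m 1 9 {{nz}} φ<1/9) 1≤d
        nz′ : NonZero m′
        nz′ = nonZero-of-<-* (C′ * m) C m′ cross-multiplied
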